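{- Let $n\ge 2$. Then \[ o_V(\Gamma_n,1) = F_{\lfloor \frac{n-(-1)^n}{2}\rfloor + 2},\quad o_V(\Gamma_n,2) = \frac12\left(F_{n+2} - F_{\lfloor \frac{n-(-1)^n}{2}\rfloor + 2}\right),\quad o_V(\Gamma_n) = \frac12\left(F_{n+2} + F_{\lfloor \frac{n-(-1)^n}{2}\rfloor + 2}\right). \]
   Context: The Fibonacci cube $\Gamma_n$ is the subgraph of the $n$-cube $Q_n$ (binary strings of length $n$, adjacent iff they differ in exactly one position) induced by the binary strings of length $n$ with no two consecutive 1s. For a graph $G$, $o_V(G)$ is the number of orbits of ${\rm Aut}(G)$ acting on $V(G)$ and $o_V(G,k)$ is the number of such orbits of size $k$. $F_m$ are Fibonacci numbers with $F_0=0$, $F_1=1$. -}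

module Defs where

open import Data.Nat using (ℕ; zero; suc; _+_; _∸_; ⌊_/2⌋)
open import Data.Bool using (Bool; true; false; _∧_; _∨_; not; if_then_else_; T)
open import Data.Vec using (Vec; []; _∷_)
open import Data.List using (List; length)
open import Data.List.Membership.Propositional using (_∈_)
open import Data.List.Relation.Unary.Unique.Propositional using (Unique)
open import Data.List.Relation.Unary.All using (All)
open import Data.List.Relation.Unary.Any using (Any)
open import Data.List.Relation.Unary.AllPairs using (AllPairs)
open import Data.Product using (Σ; ∃; ∃-syntax; _×_; _,_)
open import Function.Bundles using (_↔_; Inverse; _⇔_)
open import Relation.Binary.PropositionalEquality using (_≡_)
open import Relation.Nullary using (¬_)

F : ℕ → ℕ
F zero = 0
F (suc zero) = 1
F (suc (suc m)) = F (suc m) + F m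

record Graph : Set₁ where
  field
    V   : Set
    Adj : V → V → Set

open Graph public

record Aut (G : Graph) : Set where
  field
    perm     : V G ↔ V G
    preserve : ∀ x y → (Adj G x y ⇔ Adj G (Inverse.to perm x) (Inverse.to perm y))

SameOrbit : (G : Graph) → V G → V G → Set
SameOrbit G x y = Σ (Aut G) λ σ → Inverse.to (Aut.perm σ) x ≡ y

HasCard : (G : Graph) → (V G → Set) → ℕ → Set
HasCard G P k = Σ (List (V G)) λ xs →
  Unique xs × length xs ≡ k × (∀ x → (P x ⇔ (x ∈ xs)))

OrbitSize : (G : Graph) → V G → ℕ → Set
OrbitSize G x k = HasCard G (SameOrbit G x) k

NumOrbitsOfSize : (G : Graph) → ℕ → ℕ → Set
NumOrbitsOfSize G k m = Σ (List (V G)) λ reps →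
  length reps ≡ m ×
  AllPairs (λ x y → ¬ SameOrbit G x y) reps ×
  All (λ r → OrbitSize G r k) reps ×
  (∀ x → OrbitSize G x k → Any (λ r → SameOrbit G r x) reps)

NumOrbits : (G : Graph) → ℕ → Set
NumOrbits G m = Σ (List (V G)) λ reps →
  length reps ≡ m ×
  AllPairs (λ x y → ¬ SameOrbit G x y) reps ×
  (∀ x → Any (λ r → SameOrbit G r x) reps)

noCons : ∀ {n} → Vec Bool n → Bool
noCons [] = true
noCons (_ ∷ []) = true
noCons (a ∷ b ∷ v) = not (a ∧ b) ∧ noCons (b ∷ v)

xor : Bool → Bool → Bool
xor a b = (a ∧ not b) ∨ (not a ∧ b)

ham : ∀ {n} → Vec Bool n → Vec Bool n → ℕ
ham [] [] = 0
ham (a ∷ u) (b ∷ v) = (if xor a b then 1 else 0) + ham u v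

Γ : ℕ → Graph
Γ n = record
  { V   = Σ (Vec Bool n) (λ v → T (noCons v))
  ; Adj = λ x y → ham (Σ.proj₁ x) (Σ.proj₁ y) ≡ 1 }
  where open Data.Product

isEven : ℕ → Bool
isEven zero = true
isEven (suc n) = not (isEven n)

-- ⌊ (n - (-1)^n) / 2 ⌋
idx : ℕ → ℕ
idx n = if isEven n then ⌊ n ∸ 1 /2⌋ else ⌊ n + 1 /2⌋

module Submission where

-- First, Aut(Γ_n) = {identity, reversal} (module Rigidity).  An automorphism fixes 0,
-- the only vertex with n distinct neighbours, so it permutes the unit vertices e_i.
-- Since e_i and e_j have a common neighbour other than 0 exactly when the positions
-- i, j are not adjacent, the induced permutation of positions is an automorphism of
-- the path 0 — 1 — ⋯ — (n-1), i.e. the identity or the mirror; and an automorphism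
-- fixing 0 and every unit is the identity (induction on the number of 1s).
-- Hence the orbits are the sets {x, reverse x} (module InvolutionOrbits): the
-- palindromes are the orbits of size 1, and every other orbit has one representative
-- lexicographically smaller than its reversal.
-- Second, counting over all 2^n words: there are F_{n+2} Fibonacci words and
-- P = F_{idx n + 2} Fibonacci palindromes (P(n+4) = P(n+2) + P(n)); reversal matches
-- the words smaller than their reversal with the greater ones, so F_{n+2} = P + 2S,
-- and the three counts of the theorem are P, S and P + S.

open import Defs
open import Data.Nat using (ℕ; zero; suc; _+_; _∸_; _≤_; _<_; ⌊_/2⌋; s≤s; s≤s⁻¹) renaming (_≟_ to _≟ⁿ_)
open import Data.Nat.Properties using (m+n∸m≡n; n≡⌊n+n/2⌋; <-trans; n<1+n; suc-injective; 1+n≢n; 1+n≰n; +-∸-assoc; ≤∧≢⇒<; +-assoc; +-comm; +-identityʳ)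
open import Data.Bool using (Bool; true; false; _∧_; not; if_then_else_; T; T?)
open import Data.Bool.Properties using (not-involutive; not-¬; ¬-not; T-irrelevant; T-∧; T-≡; ∧-assoc; ∧-comm; ∧-identityʳ; ∧-zeroʳ)
open import Data.Fin using (Fin; zero; suc; toℕ; punchOut; inject₁; fromℕ; fromℕ<; opposite) renaming (_≟_ to _≟ᶠ_)
import Data.Fin.Properties as Fin
open import Data.Vec using (Vec; []; _∷_; lookup; replicate; updateAt; reverse; _∷ʳ_)
open import Data.Vec.Properties
  using (lookup∘updateAt; lookup∘updateAt′; updateAt-updateAt; updateAt-id-local; updateAt-commutes;
         lookup-replicate; reverse-∷; reverse-involutive)
open import Data.Product using (Σ; _×_; _,_; proj₁; proj₂)
import Data.Product as Product
open import Data.Sum using (_⊎_; inj₁; inj₂; [_,_]′)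
import Data.Sum as Sum
open import Data.Empty using (⊥; ⊥-elim)
open import Data.Unit using (tt)
open import Data.List using (List; []; _∷_; _++_; length; map)
open import Data.List.Properties using (length-++)
open import Data.List.Membership.Propositional using (_∈_)
open import Data.List.Membership.Propositional.Properties using (∈-map⁺; ∈-map⁻; ∈-++⁺ˡ; ∈-++⁺ʳ)
import Data.List.Relation.Unary.Unique.Propositional.Properties as Unique
open import Data.List.Relation.Unary.Any using (Any; here; there)
import Data.List.Relation.Unary.Any as Any
import Data.List.Relation.Unary.Any.Properties as AnyProperties
open import Data.List.Relation.Unary.All using (All; []; _∷_)
import Data.List.Relation.Unary.All as All
open import Data.List.Relation.Unary.AllPairs using (AllPairs; []; _∷_)
import Data.List.Relation.Unary.AllPairs.Properties as AllPairs
open import Data.List.Relation.Unary.Unique.Propositional using (Unique)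
open import Function using (_∘_; id)
open import Function.Bundles using (Inverse; Equivalence; mk⇔; mk↔ₛ′)
open import Relation.Nullary using (¬_; Dec; yes; no)
open import Relation.Nullary.Decidable using (_⊎-dec_)
open import Data.Nat.Induction using (<-wellFounded)
open import Data.Nat.Tactic.RingSolver using (solve-∀)
import Induction.WellFounded as WellFounded
import Relation.Binary.Construct.On as On
open import Relation.Binary.PropositionalEquality

private
  variable
    n : ℕ

bit : Bool → ℕ
bit b = if b then 1 else 0

toggle : Vec Bool n → Fin n → Vec Bool n
toggle v i = updateAt v i not

lookup-toggle : (v : Vec Bool n) (i : Fin n) → lookup (toggle v i) i ≡ not (lookup v i)
lookup-toggle v i = lookup∘updateAt i v

lookup-toggle-≢ : (v : Vec Bool n) {i j : Fin n} → i ≢ j → lookup (toggle v i) j ≡ lookup v j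
lookup-toggle-≢ v {i} {j} i≢j = lookup∘updateAt′ j i (λ j≡i → i≢j (sym j≡i)) v

toggle-involutive : (v : Vec Bool n) (i : Fin n) → toggle (toggle v i) i ≡ v
toggle-involutive v i = trans (updateAt-updateAt i v) (updateAt-id-local i v (not-involutive (lookup v i)))

toggle-comm : (v : Vec Bool n) {i j : Fin n} → i ≢ j → toggle (toggle v i) j ≡ toggle (toggle v j) i
toggle-comm v {i} {j} i≢j = sym (updateAt-commutes i j i≢j v)

ham-self : (u : Vec Bool n) → ham u u ≡ 0
ham-self []          = refl
ham-self (true ∷ u)  = ham-self u
ham-self (false ∷ u) = ham-self u

ham-sym : (u v : Vec Bool n) → ham u v ≡ ham v u
ham-sym []          []          = refl
ham-sym (true ∷ u)  (true ∷ v)  = ham-sym u v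
ham-sym (true ∷ u)  (false ∷ v) = cong suc (ham-sym u v)
ham-sym (false ∷ u) (true ∷ v)  = cong suc (ham-sym u v)
ham-sym (false ∷ u) (false ∷ v) = ham-sym u v

ham≡0⇒≡ : (u v : Vec Bool n) → ham u v ≡ 0 → u ≡ v
ham≡0⇒≡ []          []          _ = refl
ham≡0⇒≡ (true ∷ u)  (true ∷ v)  e = cong (true ∷_) (ham≡0⇒≡ u v e)
ham≡0⇒≡ (false ∷ u) (false ∷ v) e = cong (false ∷_) (ham≡0⇒≡ u v e)

ham-toggle : (v : Vec Bool n) (i : Fin n) → ham v (toggle v i) ≡ 1
ham-toggle (true ∷ v)  zero    = cong suc (ham-self v)
ham-toggle (false ∷ v) zero    = cong suc (ham-self v)
ham-toggle (true ∷ v)  (suc i) = ham-toggle v i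
ham-toggle (false ∷ v) (suc i) = ham-toggle v i

ham≡1⇒toggle : (u v : Vec Bool n) → ham u v ≡ 1 → Σ (Fin n) λ i → v ≡ toggle u i
ham≡1⇒toggle []          []          ()
ham≡1⇒toggle (true ∷ u)  (false ∷ v) e = zero , cong (false ∷_) (sym (ham≡0⇒≡ u v (suc-injective e)))
ham≡1⇒toggle (false ∷ u) (true ∷ v)  e = zero , cong (true ∷_) (sym (ham≡0⇒≡ u v (suc-injective e)))
ham≡1⇒toggle (true ∷ u)  (true ∷ v)  e with ham≡1⇒toggle u v e
... | i , v≡ = suc i , cong (true ∷_) v≡
ham≡1⇒toggle (false ∷ u) (false ∷ v) e with ham≡1⇒toggle u v e
... | i , v≡ = suc i , cong (false ∷_) v≡

lookup-toggle₂ : (x : Vec Bool n) {a b : Fin n} → a ≢ b → lookup (toggle (toggle x a) b) a ≡ not (lookup x a)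
lookup-toggle₂ x {a} {b} a≢b = trans (lookup-toggle-≢ (toggle x a) (λ e → a≢b (sym e))) (lookup-toggle x a)

lookup-toggle₂-≢ : (x : Vec Bool n) {a b k : Fin n} → a ≢ k → b ≢ k → lookup (toggle (toggle x a) b) k ≡ lookup x k
lookup-toggle₂-≢ x {a} a≢k b≢k = trans (lookup-toggle-≢ (toggle x a) b≢k) (lookup-toggle-≢ x a≢k)

flipped-and-kept : {a b : Bool} → a ≡ not b → a ≡ b → ⊥
flipped-and-kept flipped kept = not-¬ refl (trans (sym kept) flipped)

-- Otherwise z would be x toggled at {i, p} and also at {j, q}, impossible for p ∉ {i, j}.
common-neighbours : (x z : Vec Bool n) {i j : Fin n} → i ≢ j →
  ham (toggle x i) z ≡ 1 → ham (toggle x j) z ≡ 1 → z ≡ x ⊎ z ≡ toggle (toggle x i) j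
common-neighbours x z {i} {j} i≢j zi zj
  with ham≡1⇒toggle (toggle x i) z zi | ham≡1⇒toggle (toggle x j) z zj
... | p , refl | q , z≡ with p ≟ᶠ i | p ≟ᶠ j
...   | yes refl | _        = inj₁ (toggle-involutive x p)
...   | no _     | yes refl = inj₂ refl
...   | no p≢i   | no p≢j   with q ≟ᶠ i
...     | yes refl = ⊥-elim (flipped-and-kept
                       (trans (lookup-toggle (toggle x i) p) (cong not (lookup-toggle-≢ x (≢-sym p≢i))))
                       (trans (cong (λ w → lookup w p) z≡) (lookup-toggle₂-≢ x (≢-sym p≢j) (≢-sym p≢i))))
...     | no q≢i   = ⊥-elim (flipped-and-kept
                       (lookup-toggle₂ x (≢-sym p≢i))
                       (trans (cong (λ w → lookup w i) z≡) (lookup-toggle₂-≢ x (≢-sym i≢j) q≢i)))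

ham-∷ʳ : (u v : Vec Bool n) (a b : Bool) → ham (u ∷ʳ a) (v ∷ʳ b) ≡ ham u v + ham (a ∷ []) (b ∷ [])
ham-∷ʳ []      []      a b = refl
ham-∷ʳ (c ∷ u) (d ∷ v) a b =
  trans (cong (bit (xor c d) +_) (ham-∷ʳ u v a b)) (sym (+-assoc (bit (xor c d)) (ham u v) _))

ham-reverse : (u v : Vec Bool n) → ham (reverse u) (reverse v) ≡ ham u v
ham-reverse []      []      = refl
ham-reverse (a ∷ u) (b ∷ v) = begin
  ham (reverse (a ∷ u)) (reverse (b ∷ v))             ≡⟨ cong₂ ham (reverse-∷ a u) (reverse-∷ b v) ⟩
  ham (reverse u ∷ʳ a) (reverse v ∷ʳ b)               ≡⟨ ham-∷ʳ (reverse u) (reverse v) a b ⟩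
  ham (reverse u) (reverse v) + ham (a ∷ []) (b ∷ []) ≡⟨ cong₂ _+_ (ham-reverse u v) (+-identityʳ _) ⟩
  ham u v + bit (xor a b)                             ≡⟨ +-comm (ham u v) _ ⟩
  ham (a ∷ u) (b ∷ v)                                 ∎
  where open ≡-Reasoning

Next : Fin n → Fin n → Set
Next i j = toℕ j ≡ suc (toℕ i)

Near : Fin n → Fin n → Set
Near i j = Next i j ⊎ Next j i

near-sym : {i j : Fin n} → Near i j → Near j i
near-sym (inj₁ e) = inj₂ e
near-sym (inj₂ e) = inj₁ e

near-irrefl : {i j : Fin n} → Near i j → i ≢ j
near-irrefl (inj₁ e) refl = 1+n≢n (sym e)
near-irrefl (inj₂ e) refl = 1+n≢n (sym e)

near? : (i j : Fin n) → Dec (Near i j)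
near? i j = (toℕ j ≟ⁿ suc (toℕ i)) ⊎-dec (toℕ i ≟ⁿ suc (toℕ j))

n≢2+n : (m : ℕ) → m ≢ suc (suc m)
n≢2+n (suc m) e = n≢2+n m (suc-injective e)

near-zero : {j : Fin (suc n)} → Near zero j → toℕ j ≡ 1
near-zero (inj₁ e) = e

Sparse : Vec Bool n → Set
Sparse v = ∀ {i j} → Near i j → lookup v i ≡ true → lookup v j ≡ true → ⊥

noCons⇒sparse : (v : Vec Bool n) → T (noCons v) → Sparse v
noCons⇒sparse v h (inj₁ e) vi vj = no-next v h e vi vj
  where
  no-next : ∀ {n} (v : Vec Bool n) → T (noCons v) → ∀ {i j} → Next i j → lookup v i ≡ true → lookup v j ≡ true → ⊥
  no-next (a ∷ b ∷ w) h {zero}  {suc zero} refl refl refl = h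
  no-next (a ∷ b ∷ w) h {suc i} {suc j}    e    vi   vj   =
    no-next (b ∷ w) (proj₂ (Equivalence.to T-∧ h)) (suc-injective e) vi vj
noCons⇒sparse v h (inj₂ e) vi vj = noCons⇒sparse v h (inj₁ e) vj vi

sparse⇒noCons : (v : Vec Bool n) → Sparse v → T (noCons v)
sparse⇒noCons []          _ = tt
sparse⇒noCons (a ∷ [])    _ = tt
sparse⇒noCons (a ∷ b ∷ w) s = Equivalence.from T-∧ (not-both a b refl refl , sparse⇒noCons (b ∷ w) tail-sparse)
  where
  not-both : ∀ x y → a ≡ x → b ≡ y → T (not (x ∧ y))
  not-both true  true  a≡ b≡ = s {zero} {suc zero} (inj₁ refl) a≡ b≡
  not-both true  false _  _  = tt
  not-both false _     _  _  = tt
  tail-sparse : Sparse (b ∷ w)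
  tail-sparse (inj₁ e) vi vj = s (inj₁ (cong suc e)) vi vj
  tail-sparse (inj₂ e) vi vj = s (inj₂ (cong suc e)) vi vj

Vertex : ℕ → Set
Vertex n = V (Γ n)

vertex-≡ : {x y : Vertex n} → proj₁ x ≡ proj₁ y → x ≡ y
vertex-≡ {x = v , h} {y = .v , h′} refl = cong (v ,_) (T-irrelevant h h′)

vertex : (v : Vec Bool n) → Sparse v → Vertex n
vertex v s = v , sparse⇒noCons v s

sparse : (x : Vertex n) → Sparse (proj₁ x)
sparse (v , h) = noCons⇒sparse v h

sparse-mono : {v w : Vec Bool n} → (∀ k → lookup w k ≡ true → lookup v k ≡ true) → Sparse v → Sparse w
sparse-mono w⊆v s near wi wj = s near (w⊆v _ wi) (w⊆v _ wj)

sparse-pair : (w : Vec Bool n) {i j : Fin n} → ¬ Near i j → (∀ k → lookup w k ≡ true → k ≡ i ⊎ k ≡ j) → Sparse w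
sparse-pair w {i} {j} ¬near ones {a} {b} near wa wb = apart (ones a wa) (ones b wb) near
  where
  apart : ∀ {a b} → a ≡ i ⊎ a ≡ j → b ≡ i ⊎ b ≡ j → Near a b → ⊥
  apart (inj₁ refl) (inj₁ refl) near = near-irrefl near refl
  apart (inj₁ refl) (inj₂ refl) near = ¬near near
  apart (inj₂ refl) (inj₁ refl) near = ¬near (near-sym near)
  apart (inj₂ refl) (inj₂ refl) near = near-irrefl near refl

zeros : (n : ℕ) → Vec Bool n
zeros n = replicate n false

unit : Fin n → Vec Bool n
unit {n} i = toggle (zeros n) i

lookup-zeros : (k : Fin n) → lookup (zeros n) k ≡ false
lookup-zeros k = lookup-replicate k false

lookup-unit : (i : Fin n) → lookup (unit i) i ≡ true
lookup-unit {n} i = trans (lookup-toggle (zeros n) i) (cong not (lookup-zeros i))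

lookup-unit-≢ : {i k : Fin n} → i ≢ k → lookup (unit i) k ≡ false
lookup-unit-≢ {n} {k = k} i≢k = trans (lookup-toggle-≢ (zeros n) i≢k) (lookup-zeros k)

true≢false : true ≢ false
true≢false ()

unit-one : (i : Fin n) {k : Fin n} → lookup (unit i) k ≡ true → k ≡ i
unit-one i {k} uk with i ≟ᶠ k
... | yes i≡k = sym i≡k
... | no  i≢k = ⊥-elim (true≢false (trans (sym uk) (lookup-unit-≢ {i = i} i≢k)))

unit-injective : {i j : Fin n} → unit i ≡ unit j → i ≡ j
unit-injective {i = i} e = unit-one _ (trans (cong (λ w → lookup w i) (sym e)) (lookup-unit i))

0ᵛ : Vertex n
0ᵛ {n} = vertex (zeros n) (λ {i} _ z _ → true≢false (trans (sym z) (lookup-zeros i)))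

eᵛ : Fin n → Vertex n
eᵛ i = vertex (unit i) (sparse-pair (unit i) (λ near → near-irrefl near refl) (λ k uk → inj₁ (unit-one i uk)))

_∼_ : Vertex n → Vertex n → Set
_∼_ {n} = Adj (Γ n)

∼-sym : {x y : Vertex n} → x ∼ y → y ∼ x
∼-sym {x = x} {y} x∼y = trans (ham-sym (proj₁ y) (proj₁ x)) x∼y

0∼e : (i : Fin n) → 0ᵛ ∼ eᵛ i
0∼e {n} i = ham-toggle (zeros n) i

neighbour-of-0 : (y : Vertex n) → 0ᵛ ∼ y → Σ (Fin n) λ i → y ≡ eᵛ i
neighbour-of-0 {n} y 0∼y with ham≡1⇒toggle (zeros n) (proj₁ y) 0∼y
... | i , y≡ = i , vertex-≡ y≡

headᵇ : Vec Bool n → Bool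
headᵇ []      = false
headᵇ (a ∷ _) = a

lastᵇ : Vec Bool n → Bool
lastᵇ []          = false
lastᵇ (a ∷ [])    = a
lastᵇ (_ ∷ b ∷ v) = lastᵇ (b ∷ v)

lastᵇ-∷ʳ : (v : Vec Bool n) (a : Bool) → lastᵇ (v ∷ʳ a) ≡ a
lastᵇ-∷ʳ []          a = refl
lastᵇ-∷ʳ (_ ∷ [])    a = refl
lastᵇ-∷ʳ (_ ∷ b ∷ v) a = lastᵇ-∷ʳ (b ∷ v) a

lastᵇ-reverse : (v : Vec Bool n) → lastᵇ (reverse v) ≡ headᵇ v
lastᵇ-reverse []      = refl
lastᵇ-reverse (a ∷ v) = trans (cong lastᵇ (reverse-∷ a v)) (lastᵇ-∷ʳ (reverse v) a)

noCons-∷ : (a : Bool) (v : Vec Bool n) → noCons (a ∷ v) ≡ not (a ∧ headᵇ v) ∧ noCons v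
noCons-∷ true  []      = refl
noCons-∷ false []      = refl
noCons-∷ a     (b ∷ v) = refl

noCons-∷ʳ : (v : Vec Bool n) (a : Bool) → noCons (v ∷ʳ a) ≡ noCons v ∧ not (lastᵇ v ∧ a)
noCons-∷ʳ []          a = refl
noCons-∷ʳ (b ∷ [])    a = ∧-identityʳ _
noCons-∷ʳ (b ∷ c ∷ w) a =
  trans (cong (not (b ∧ c) ∧_) (noCons-∷ʳ (c ∷ w) a)) (sym (∧-assoc (not (b ∧ c)) (noCons (c ∷ w)) _))

noCons-reverse : (v : Vec Bool n) → noCons (reverse v) ≡ noCons v
noCons-reverse []      = refl
noCons-reverse (a ∷ v) = begin
  noCons (reverse (a ∷ v))                               ≡⟨ cong noCons (reverse-∷ a v) ⟩
  noCons (reverse v ∷ʳ a)                                ≡⟨ noCons-∷ʳ (reverse v) a ⟩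
  noCons (reverse v) ∧ not (lastᵇ (reverse v) ∧ a)       ≡⟨ cong₂ (λ b c → b ∧ not (c ∧ a)) (noCons-reverse v) (lastᵇ-reverse v) ⟩
  noCons v ∧ not (headᵇ v ∧ a)                           ≡⟨ cong (λ b → noCons v ∧ not b) (∧-comm (headᵇ v) a) ⟩
  noCons v ∧ not (a ∧ headᵇ v)                           ≡⟨ ∧-comm (noCons v) _ ⟩
  not (a ∧ headᵇ v) ∧ noCons v                           ≡⟨ noCons-∷ a v ⟨
  noCons (a ∷ v)                                         ∎
  where open ≡-Reasoning

reverseᵛ : Vertex n → Vertex n
reverseᵛ (v , h) = reverse v , subst T (sym (noCons-reverse v)) h

reverseᵛ-involutive : (x : Vertex n) → reverseᵛ (reverseᵛ x) ≡ x
reverseᵛ-involutive (v , _) = vertex-≡ (reverse-involutive v)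

reverseᵛ-∼ : (x y : Vertex n) → (x ∼ y) ≡ (reverseᵛ x ∼ reverseᵛ y)
reverseᵛ-∼ (u , _) (v , _) = cong (_≡ 1) (sym (ham-reverse u v))

data Shape {n : ℕ} (v : Vec Bool n) : Set where
  empty  : v ≡ zeros n → Shape v
  single : (i : Fin n) → v ≡ unit i → Shape v
  double : {i j : Fin n} → i ≢ j → lookup v i ≡ true → lookup v j ≡ true → Shape v

shape : (v : Vec Bool n) → Shape v
shape []          = empty refl
shape (false ∷ v) with shape v
... | empty v≡          = empty (cong (false ∷_) v≡)
... | single i v≡       = single (suc i) (cong (false ∷_) v≡)
... | double i≢j vi vj  = double (λ e → i≢j (Fin.suc-injective e)) vi vj
shape (true ∷ v)  with shape v
... | empty v≡          = single zero (cong (true ∷_) v≡)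
... | single i v≡       = double {i = zero} {suc i} (λ ()) refl (trans (cong (λ w → lookup w i) v≡) (lookup-unit i))
... | double {i} _ vi _ = double {i = zero} {suc i} (λ ()) refl vi

has-near : {k : ℕ} (p : Fin (suc (suc k))) → Σ (Fin (suc (suc k))) (Near p)
has-near             zero          = suc zero , inj₁ refl
has-near {zero}      (suc zero)    = zero , inj₂ refl
has-near {suc k}     (suc p) with has-near {k} p
... | q , inj₁ e = suc q , inj₁ (cong suc e)
... | q , inj₂ e = suc q , inj₂ (cong suc e)

-- At a position q next to p it has a 0 which cannot
-- be toggled, so all neighbours of y are toggles at the n - 1 positions other than q.
one⇒small-degree : {k : ℕ} (y : Vertex (suc (suc k))) (φ : Fin (suc (suc k)) → Vertex (suc (suc k))) →
  (∀ i → y ∼ φ i) → (∀ {i j} → φ i ≡ φ j → i ≡ j) → {p : Fin (suc (suc k))} → lookup (proj₁ y) p ≡ true → ⊥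
one⇒small-degree {k} (y , y-fib) φ y∼φ φ-injective {p} yp = 1+n≰n (Fin.injective⇒≤ squeezed-injective)
  where
  q : Fin (suc (suc k))
  q = proj₁ (has-near p)
  p~q : Near p q
  p~q = proj₂ (has-near p)
  yq : lookup y q ≡ false
  yq = ¬-not (λ yq → noCons⇒sparse y y-fib p~q yp yq)
  position : Fin (suc (suc k)) → Fin (suc (suc k))
  position i = proj₁ (ham≡1⇒toggle y (proj₁ (φ i)) (y∼φ i))
  φ≡ : ∀ i → proj₁ (φ i) ≡ toggle y (position i)
  φ≡ i = proj₂ (ham≡1⇒toggle y (proj₁ (φ i)) (y∼φ i))
  -- toggling y at q would put adjacent 1s at p and q
  q-blocked : ∀ i → q ≢ position i
  q-blocked i q≡ = sparse (φ i) p~q p-one q-one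
    where
    φ≡′ : proj₁ (φ i) ≡ toggle y q
    φ≡′ = trans (φ≡ i) (cong (toggle y) (sym q≡))
    p-one : lookup (proj₁ (φ i)) p ≡ true
    p-one = trans (cong (λ w → lookup w p) φ≡′) (trans (lookup-toggle-≢ y (near-irrefl (near-sym p~q))) yp)
    q-one : lookup (proj₁ (φ i)) q ≡ true
    q-one = trans (cong (λ w → lookup w q) φ≡′) (trans (lookup-toggle y q) (cong not yq))
  squeezed-injective : ∀ {i j} → punchOut (q-blocked i) ≡ punchOut (q-blocked j) → i ≡ j
  squeezed-injective {i} {j} e = φ-injective (vertex-≡ (begin
    proj₁ (φ i)            ≡⟨ φ≡ i ⟩
    toggle y (position i)  ≡⟨ cong (toggle y) (Fin.punchOut-injective (q-blocked i) (q-blocked j) e) ⟩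
    toggle y (position j)  ≡⟨ φ≡ j ⟨
    proj₁ (φ j)            ∎))
    where open ≡-Reasoning

full-degree⇒zero : {k : ℕ} (y : Vertex (suc (suc k))) (φ : Fin (suc (suc k)) → Vertex (suc (suc k))) →
  (∀ i → y ∼ φ i) → (∀ {i j} → φ i ≡ φ j → i ≡ j) → y ≡ 0ᵛ
full-degree⇒zero y φ y∼φ φ-injective with shape (proj₁ y)
... | empty y≡      = vertex-≡ y≡
... | single p y≡   = ⊥-elim (one⇒small-degree y φ y∼φ φ-injective
                                (trans (cong (λ w → lookup w p) y≡) (lookup-unit p)))
... | double _ yp _ = ⊥-elim (one⇒small-degree y φ y∼φ φ-injective yp)

MeetOnlyAt0 : Vertex n → Vertex n → Set
MeetOnlyAt0 a b = ∀ w → a ∼ w → b ∼ w → w ≡ 0ᵛ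

lookup-pair-i : {i j : Fin n} → i ≢ j → lookup (toggle (unit i) j) i ≡ true
lookup-pair-i {i = i} i≢j = trans (lookup-toggle-≢ (unit i) (≢-sym i≢j)) (lookup-unit i)

lookup-pair-j : {i j : Fin n} → i ≢ j → lookup (toggle (unit i) j) j ≡ true
lookup-pair-j {i = i} {j} i≢j = trans (lookup-toggle (unit i) j) (cong not (lookup-unit-≢ i≢j))

-- Adjacency of positions is visible in Γ_n: for i ≠ j, the units e_i and e_j
-- meet only at 0 iff i and j are adjacent, the other common neighbour of e_i and e_j
-- in Q_n being e_i + e_j, which is a Fibonacci word iff i, j are not adjacent.
near⇒meet-only-at-0 : {i j : Fin n} → Near i j → MeetOnlyAt0 (eᵛ i) (eᵛ j)
near⇒meet-only-at-0 {n} {i} {j} near w i∼w j∼w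
  with common-neighbours (zeros n) (proj₁ w) (near-irrefl near) i∼w j∼w
... | inj₁ w≡0  = vertex-≡ w≡0
... | inj₂ w≡ij = ⊥-elim (sparse w near (trans (cong (λ v → lookup v i) w≡ij) (lookup-pair-i (near-irrefl near)))
                                        (trans (cong (λ v → lookup v j) w≡ij) (lookup-pair-j (near-irrefl near))))

meet-only-at-0⇒near : {i j : Fin n} → i ≢ j → MeetOnlyAt0 (eᵛ i) (eᵛ j) → Near i j
meet-only-at-0⇒near {n} {i} {j} i≢j meet with near? i j
... | yes near = near
... | no ¬near = ⊥-elim (true≢false (trans (sym (lookup-pair-i i≢j)) (trans (cong (λ v → lookup (proj₁ v) i) w≡0) (lookup-zeros i))))
  where
  ones : ∀ k → lookup (toggle (unit i) j) k ≡ true → k ≡ i ⊎ k ≡ j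
  ones k wk with j ≟ᶠ k
  ... | yes j≡k = inj₂ (sym j≡k)
  ... | no  j≢k = inj₁ (unit-one i (trans (sym (lookup-toggle-≢ (unit i) j≢k)) wk))
  w : Vertex n
  w = vertex (toggle (unit i) j) (sparse-pair (toggle (unit i) j) ¬near ones)
  j∼w : eᵛ j ∼ w
  j∼w = subst (λ v → ham (unit j) v ≡ 1) (sym (toggle-comm (zeros n) i≢j)) (ham-toggle (unit j) i)
  w≡0 : w ≡ 0ᵛ
  w≡0 = meet w (ham-toggle (unit i) j) j∼w

opposite-next : {i j : Fin n} → Next i j → Next (opposite j) (opposite i)
opposite-next {suc m} {i} {j} e = begin
  toℕ (opposite i)         ≡⟨ Fin.opposite-prop i ⟩
  suc m ∸ suc (toℕ i)      ≡⟨ +-∸-assoc 1 (subst (_≤ m) e (s≤s⁻¹ (Fin.toℕ<n j))) ⟩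
  suc (m ∸ suc (toℕ i))    ≡⟨ cong (λ t → suc (m ∸ t)) e ⟨
  suc (m ∸ toℕ j)          ≡⟨ cong suc (Fin.opposite-prop j) ⟨
  suc (toℕ (opposite j))   ∎
  where open ≡-Reasoning

opposite-near : {i j : Fin n} → Near i j → Near (opposite i) (opposite j)
opposite-near (inj₁ e) = inj₂ (opposite-next e)
opposite-near (inj₂ e) = inj₁ (opposite-next e)

unique-neighbour⇒endpoint : {k : ℕ} (p : Fin (suc (suc k))) →
  (∀ {a b} → Near p a → Near p b → a ≡ b) → p ≡ zero ⊎ p ≡ opposite zero
unique-neighbour⇒endpoint     zero    _      = inj₁ refl
unique-neighbour⇒endpoint {k} (suc q) unique with toℕ q ≟ⁿ k
... | yes q≡k = inj₂ (Fin.toℕ-injective (cong suc (trans q≡k (sym (Fin.toℕ-fromℕ k)))))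
-- otherwise the neighbours q and q + 2 of suc q would coincide
... | no  q≢k = ⊥-elim (n≢2+n (toℕ q) (begin
  toℕ q                     ≡⟨ Fin.toℕ-inject₁ q ⟨
  toℕ (inject₁ q)           ≡⟨ cong toℕ before≡after ⟩
  toℕ (fromℕ< after<)       ≡⟨ Fin.toℕ-fromℕ< after< ⟩
  suc (suc (toℕ q))         ∎))
  where
  open ≡-Reasoning
  after< : suc (suc (toℕ q)) < suc (suc k)
  after< = s≤s (s≤s (≤∧≢⇒< (s≤s⁻¹ (Fin.toℕ<n q)) q≢k))
  before≡after : inject₁ q ≡ fromℕ< after<
  before≡after = unique (inj₂ (cong suc (sym (Fin.toℕ-inject₁ q)))) (inj₁ (Fin.toℕ-fromℕ< after<))

predecessor : (i : Fin (suc n)) {t : ℕ} → toℕ i ≡ suc t → Σ (Fin (suc n)) λ i′ → toℕ i′ ≡ t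
predecessor (suc j) e = inject₁ j , trans (Fin.toℕ-inject₁ j) (suc-injective e)

-- An injective self-map of the path preserving adjacency and fixing the first
-- position is the identity: by induction along the path, position t+2 must go to
-- a neighbour of t+1 other than t.
path-fixing-start : {m : ℕ} (π : Fin (suc m) → Fin (suc m)) → (∀ {i j} → π i ≡ π j → i ≡ j) →
  (∀ {i j} → Near i j → Near (π i) (π j)) → π zero ≡ zero → ∀ i → π i ≡ i
path-fixing-start {m} π π-injective π-near π0 i = Fin.toℕ-injective (proj₁ (fixed-from (toℕ i)) i refl)
  where
  Fixes : ℕ → Set
  Fixes t = ∀ i → toℕ i ≡ t → toℕ (π i) ≡ t

  fixes-0 : Fixes 0
  fixes-0 i e with Fin.toℕ-injective {i = i} {j = zero} e
  ... | refl = cong toℕ π0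

  fixes-1 : Fixes 1
  fixes-1 i e = near-zero (subst (λ p → Near p (π i)) π0 (π-near (inj₁ e)))

  fixes-step : ∀ t → Fixes t → Fixes (suc t) → Fixes (suc (suc t))
  fixes-step t fixes-t fixes-t+1 i e with predecessor i e
  ... | i′ , e′ with predecessor i′ e′ | π-near {i′} {i} (inj₁ (trans e (cong suc (sym e′))))
  ...   | _      , e″ | inj₁ next = trans next (cong suc (fixes-t+1 i′ e′))
  ...   | i″     , e″ | inj₂ prev = ⊥-elim (n≢2+n t (begin
    t                  ≡⟨ e″ ⟨
    toℕ i″             ≡⟨ cong toℕ (π-injective (Fin.toℕ-injective (trans π-i″ (sym π-i)))) ⟩
    toℕ i              ≡⟨ e ⟩
    suc (suc t)        ∎))
    where
    open ≡-Reasoning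
    π-i : toℕ (π i) ≡ t
    π-i = suc-injective (trans (sym prev) (fixes-t+1 i′ e′))
    π-i″ : toℕ (π i″) ≡ t
    π-i″ = fixes-t i″ e″

  fixed-from : ∀ t → Fixes t × Fixes (suc t)
  fixed-from zero    = fixes-0 , fixes-1
  fixed-from (suc t) = proj₂ (fixed-from t) , fixes-step t (proj₁ (fixed-from t)) (proj₂ (fixed-from t))

-- The image of the endpoint 0 has a
-- unique neighbour, hence is an endpoint; in the second case compose with the mirror.
path-rigidity : {k : ℕ} (π ρ : Fin (suc (suc k)) → Fin (suc (suc k))) →
  (∀ {i j} → π i ≡ π j → i ≡ j) → (∀ j → π (ρ j) ≡ j) →
  (∀ {i j} → Near i j → Near (π i) (π j)) → (∀ {i j} → Near (π i) (π j) → Near i j) →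
  (∀ i → π i ≡ i) ⊎ (∀ i → π i ≡ opposite i)
path-rigidity π ρ π-injective π∘ρ π-near π-near⁻ with unique-neighbour⇒endpoint (π zero) π0-unique
  where
  π0-unique : ∀ {a b} → Near (π zero) a → Near (π zero) b → a ≡ b
  π0-unique {a} {b} near-a near-b = begin
    a          ≡⟨ π∘ρ a ⟨
    π (ρ a)    ≡⟨ cong π (Fin.toℕ-injective (trans (near-zero (reflect near-a)) (sym (near-zero (reflect near-b))))) ⟩
    π (ρ b)    ≡⟨ π∘ρ b ⟩
    b          ∎
    where
    open ≡-Reasoning
    reflect : ∀ {c} → Near (π zero) c → Near zero (ρ c)
    reflect {c} near = π-near⁻ (subst (Near (π zero)) (sym (π∘ρ c)) near)
... | inj₁ π0≡0   = inj₁ (path-fixing-start π π-injective π-near π0≡0)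
... | inj₂ π0≡end = inj₂ λ i → begin
  π i                         ≡⟨ Fin.opposite-involutive (π i) ⟨
  opposite (opposite (π i))   ≡⟨ cong opposite (path-fixing-start (opposite ∘ π) mirrored-injective
                                   (λ near → opposite-near (π-near near)) mirrored-0 i) ⟩
  opposite i                  ∎
  where
  open ≡-Reasoning
  mirrored-injective : ∀ {i j} → opposite (π i) ≡ opposite (π j) → i ≡ j
  mirrored-injective e = π-injective (trans (sym (Fin.opposite-involutive _)) (trans (cong opposite e) (Fin.opposite-involutive _)))
  mirrored-0 : opposite (π zero) ≡ zero
  mirrored-0 = trans (cong opposite π0≡end) (Fin.opposite-involutive zero)

weight : Vec Bool n → ℕ
weight []          = 0
weight (true ∷ v)  = suc (weight v)
weight (false ∷ v) = weight v

weight-toggle-off : (v : Vec Bool n) (i : Fin n) → lookup v i ≡ true → weight (toggle v i) < weight v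
weight-toggle-off (true ∷ v)  zero    _  = n<1+n (weight v)
weight-toggle-off (true ∷ v)  (suc i) vi = s≤s (weight-toggle-off v i vi)
weight-toggle-off (false ∷ v) (suc i) vi = weight-toggle-off v i vi

turn-off : (x : Vertex n) {i : Fin n} → lookup (proj₁ x) i ≡ true → Vertex n
turn-off (v , h) {i} vi = vertex (toggle v i) (sparse-mono {v = v} {w = toggle v i} ones-kept (noCons⇒sparse v h))
  where
  ones-kept : ∀ k → lookup (toggle v i) k ≡ true → lookup v k ≡ true
  ones-kept k wk with i ≟ᶠ k
  ... | yes refl = ⊥-elim (flipped-and-kept (trans (lookup-toggle v i) (cong not vi)) wk)
  ... | no  i≢k  = trans (sym (lookup-toggle-≢ v i≢k)) wk

-- By induction on the weight: a vertex x with 1s at i ≠ j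
-- is a common neighbour of its lighter neighbours a = x - e_i and b = x - e_j, which
-- h fixes; their only other common neighbour is c = x - e_i - e_j = h c, and h x ≠ h c.
fixing-units⇒identity : (h : Vertex n → Vertex n) → (∀ {x y} → h x ≡ h y → x ≡ y) →
  (∀ {x y} → x ∼ y → h x ∼ h y) → h 0ᵛ ≡ 0ᵛ → (∀ i → h (eᵛ i) ≡ eᵛ i) → ∀ x → h x ≡ x
fixing-units⇒identity {n} h h-injective h-∼ h0 h-units =
  WellFounded.All.wfRec (On.wellFounded (weight ∘ proj₁) <-wellFounded) _ (λ x → h x ≡ x) step
  where
  Lighter-fixed : Vertex n → Set
  Lighter-fixed x = ∀ {y} → weight (proj₁ y) < weight (proj₁ x) → h y ≡ y

  -- h x is adjacent to each lighter neighbour of x, since h fixes it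
  toward : ∀ x → Lighter-fixed x → ∀ {k} (xk : lookup (proj₁ x) k ≡ true) → ham (toggle (proj₁ x) k) (proj₁ (h x)) ≡ 1
  toward x lighter {k} xk = subst (λ y → ham (proj₁ y) (proj₁ (h x)) ≡ 1) (lighter {turn-off x xk} (weight-toggle-off (proj₁ x) k xk))
                              (∼-sym {x = h x} {h (turn-off x xk)} (h-∼ {x} {turn-off x xk} (ham-toggle (proj₁ x) k)))

  two-ones : ∀ x → Lighter-fixed x → ∀ {i j} → i ≢ j → lookup (proj₁ x) i ≡ true → lookup (proj₁ x) j ≡ true → h x ≡ x
  two-ones x@(v , _) lighter {i} {j} i≢j vi vj with common-neighbours v (proj₁ (h x)) i≢j (toward x lighter vi) (toward x lighter vj)
  ... | inj₁ hx≡x = vertex-≡ hx≡x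
  ... | inj₂ hx≡c = ⊥-elim (flipped-and-kept (lookup-toggle₂ v i≢j) (cong (λ y → lookup (proj₁ y) i) (sym x≡c)))
    where
    vj′ : lookup (toggle v i) j ≡ true
    vj′ = trans (lookup-toggle-≢ v i≢j) vj
    c : Vertex n
    c = turn-off (turn-off x vi) vj′
    hc≡c : h c ≡ c
    hc≡c = lighter (<-trans (weight-toggle-off (toggle v i) j vj′) (weight-toggle-off v i vi))
    x≡c : x ≡ c
    x≡c = h-injective (trans (vertex-≡ hx≡c) (sym hc≡c))

  step : ∀ x → Lighter-fixed x → h x ≡ x
  step x@(v , _) lighter with shape v
  ... | empty v≡           = trans (cong h (vertex-≡ v≡)) (trans h0 (vertex-≡ (sym v≡)))
  ... | single i v≡        = trans (cong h (vertex-≡ v≡)) (trans (h-units i) (vertex-≡ (sym v≡)))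
  ... | double i≢j vi vj   = two-ones x lighter i≢j vi vj

zeros-∷ʳ : (n : ℕ) → zeros n ∷ʳ false ≡ zeros (suc n)
zeros-∷ʳ zero    = refl
zeros-∷ʳ (suc n) = cong (false ∷_) (zeros-∷ʳ n)

toggle-∷ʳ : (v : Vec Bool n) (i : Fin n) (a : Bool) → toggle v i ∷ʳ a ≡ toggle (v ∷ʳ a) (inject₁ i)
toggle-∷ʳ (b ∷ v) zero    a = refl
toggle-∷ʳ (b ∷ v) (suc i) a = cong (b ∷_) (toggle-∷ʳ v i a)

toggle-last : (v : Vec Bool n) (a : Bool) → v ∷ʳ not a ≡ toggle (v ∷ʳ a) (fromℕ n)
toggle-last []      a = refl
toggle-last (b ∷ v) a = cong (b ∷_) (toggle-last v a)

reverse-zeros : (n : ℕ) → reverse (zeros n) ≡ zeros n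
reverse-zeros zero    = refl
reverse-zeros (suc n) = begin
  reverse (false ∷ zeros n)   ≡⟨ reverse-∷ false (zeros n) ⟩
  reverse (zeros n) ∷ʳ false  ≡⟨ cong (_∷ʳ false) (reverse-zeros n) ⟩
  zeros n ∷ʳ false            ≡⟨ zeros-∷ʳ n ⟩
  zeros (suc n)               ∎
  where open ≡-Reasoning

reverse-unit : (i : Fin n) → reverse (unit i) ≡ unit (opposite i)
reverse-unit {suc n} zero = begin
  reverse (true ∷ zeros n)                   ≡⟨ reverse-∷ true (zeros n) ⟩
  reverse (zeros n) ∷ʳ true                  ≡⟨ cong (_∷ʳ true) (reverse-zeros n) ⟩
  zeros n ∷ʳ not false                       ≡⟨ toggle-last (zeros n) false ⟩
  toggle (zeros n ∷ʳ false) (fromℕ n)        ≡⟨ cong (λ v → toggle v (fromℕ n)) (zeros-∷ʳ n) ⟩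
  unit (fromℕ n)                             ∎
  where open ≡-Reasoning
reverse-unit {suc n} (suc i) = begin
  reverse (false ∷ unit i)                        ≡⟨ reverse-∷ false (unit i) ⟩
  reverse (unit i) ∷ʳ false                       ≡⟨ cong (_∷ʳ false) (reverse-unit i) ⟩
  toggle (zeros n) (opposite i) ∷ʳ false          ≡⟨ toggle-∷ʳ (zeros n) (opposite i) false ⟩
  toggle (zeros n ∷ʳ false) (inject₁ (opposite i)) ≡⟨ cong (λ v → toggle v (inject₁ (opposite i))) (zeros-∷ʳ n) ⟩
  unit (opposite (suc i))                         ∎
  where open ≡-Reasoning

-- It fixes 0 (the unique vertex of full degree), so it permutes the units e_i by
-- some π; since e_i, e_j meet only at 0 exactly when i, j are adjacent positions,
-- π is an automorphism of the path, hence the identity or the mirror, and an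
-- automorphism is determined by its action on the units.
module Rigidity {k : ℕ} (σ : Aut (Γ (suc (suc k)))) where

  private
    N : ℕ
    N = suc (suc k)

  f g : Vertex N → Vertex N
  f = Inverse.to (Aut.perm σ)
  g = Inverse.from (Aut.perm σ)

  f∘g : ∀ y → f (g y) ≡ y
  f∘g = Inverse.strictlyInverseˡ (Aut.perm σ)

  f-injective : ∀ {x y} → f x ≡ f y → x ≡ y
  f-injective {x} {y} e = trans (sym (Inverse.strictlyInverseʳ (Aut.perm σ) x))
                                (trans (cong g e) (Inverse.strictlyInverseʳ (Aut.perm σ) y))

  f-∼ : ∀ {x y} → x ∼ y → f x ∼ f y
  f-∼ {x} {y} = Equivalence.to (Aut.preserve σ x y)

  g-∼ : ∀ {x y} → x ∼ y → g x ∼ g y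
  g-∼ {x} {y} x∼y = Equivalence.from (Aut.preserve σ (g x) (g y)) (subst₂ _∼_ (sym (f∘g x)) (sym (f∘g y)) x∼y)

  f0 : f 0ᵛ ≡ 0ᵛ
  f0 = full-degree⇒zero (f 0ᵛ) (f ∘ eᵛ) (λ i → f-∼ (0∼e i)) (λ e → unit-injective (cong proj₁ (f-injective e)))

  g0 : g 0ᵛ ≡ 0ᵛ
  g0 = f-injective (trans (f∘g 0ᵛ) (sym f0))

  -- f and g map units to neighbours of 0, i.e. to units: this defines the
  -- permutations π and ρ of positions
  f-unit-image : ∀ i → Σ (Fin N) λ j → f (eᵛ i) ≡ eᵛ j
  f-unit-image i = neighbour-of-0 (f (eᵛ i)) (subst (_∼ f (eᵛ i)) f0 (f-∼ (0∼e i)))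

  g-unit-image : ∀ i → Σ (Fin N) λ j → g (eᵛ i) ≡ eᵛ j
  g-unit-image i = neighbour-of-0 (g (eᵛ i)) (subst (_∼ g (eᵛ i)) g0 (g-∼ (0∼e i)))

  π ρ : Fin N → Fin N
  π i = proj₁ (f-unit-image i)
  ρ j = proj₁ (g-unit-image j)

  f-unit : ∀ i → f (eᵛ i) ≡ eᵛ (π i)
  f-unit i = proj₂ (f-unit-image i)

  g-unit : ∀ j → g (eᵛ j) ≡ eᵛ (ρ j)
  g-unit j = proj₂ (g-unit-image j)

  eᵛ-injective : ∀ {i j : Fin N} → eᵛ i ≡ eᵛ j → i ≡ j
  eᵛ-injective e = unit-injective (cong proj₁ e)

  π-injective : ∀ {i j} → π i ≡ π j → i ≡ j
  π-injective {i} {j} e = eᵛ-injective (f-injective (trans (f-unit i) (trans (cong eᵛ e) (sym (f-unit j)))))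

  π∘ρ : ∀ j → π (ρ j) ≡ j
  π∘ρ j = eᵛ-injective (trans (sym (f-unit (ρ j))) (trans (cong f (sym (g-unit j))) (f∘g (eᵛ j))))

  meet-f : ∀ {a b} → MeetOnlyAt0 a b → MeetOnlyAt0 (f a) (f b)
  meet-f {a} {b} meet w fa∼w fb∼w = begin
    w          ≡⟨ f∘g w ⟨
    f (g w)    ≡⟨ cong f (meet (g w) (back fa∼w) (back fb∼w)) ⟩
    f 0ᵛ       ≡⟨ f0 ⟩
    0ᵛ         ∎
    where
    open ≡-Reasoning
    back : ∀ {c} → f c ∼ w → c ∼ g w
    back {c} fc∼w = subst (_∼ g w) (Inverse.strictlyInverseʳ (Aut.perm σ) c) (g-∼ fc∼w)

  meet-f⁻ : ∀ {a b} → MeetOnlyAt0 (f a) (f b) → MeetOnlyAt0 a b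
  meet-f⁻ meet w a∼w b∼w = f-injective (trans (meet (f w) (f-∼ a∼w) (f-∼ b∼w)) (sym f0))

  π-near : ∀ {i j} → Near i j → Near (π i) (π j)
  π-near {i} {j} near = meet-only-at-0⇒near (λ e → near-irrefl near (π-injective e))
    (subst₂ MeetOnlyAt0 (f-unit i) (f-unit j) (meet-f (near⇒meet-only-at-0 near)))

  π-near⁻ : ∀ {i j} → Near (π i) (π j) → Near i j
  π-near⁻ {i} {j} near = meet-only-at-0⇒near (λ e → near-irrefl near (cong π e))
    (meet-f⁻ (subst₂ MeetOnlyAt0 (sym (f-unit i)) (sym (f-unit j)) (near⇒meet-only-at-0 near)))

  identity-case : (∀ i → π i ≡ i) → ∀ x → f x ≡ x
  identity-case π-id = fixing-units⇒identity f f-injective f-∼ f0 (λ i → trans (f-unit i) (cong eᵛ (π-id i)))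

  -- if π is the mirror, reverseᵛ ∘ f fixes every unit
  rev-f-injective : ∀ {x y} → reverseᵛ (f x) ≡ reverseᵛ (f y) → x ≡ y
  rev-f-injective e = f-injective (trans (sym (reverseᵛ-involutive _)) (trans (cong reverseᵛ e) (reverseᵛ-involutive _)))

  rev-f-∼ : ∀ {x y} → x ∼ y → reverseᵛ (f x) ∼ reverseᵛ (f y)
  rev-f-∼ {x} {y} x∼y = subst id (reverseᵛ-∼ (f x) (f y)) (f-∼ x∼y)

  rev-f0 : reverseᵛ (f 0ᵛ) ≡ 0ᵛ
  rev-f0 = trans (cong reverseᵛ f0) (vertex-≡ (reverse-zeros N))

  rev-f-unit : (∀ i → π i ≡ opposite i) → ∀ i → reverseᵛ (f (eᵛ i)) ≡ eᵛ i
  rev-f-unit π-opp i = trans (cong reverseᵛ (trans (f-unit i) (cong eᵛ (π-opp i))))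
    (vertex-≡ {x = reverseᵛ (eᵛ (opposite i))} {eᵛ i} (trans (reverse-unit (opposite i)) (cong unit (Fin.opposite-involutive i))))

  mirror-case : (∀ i → π i ≡ opposite i) → ∀ x → f x ≡ reverseᵛ x
  mirror-case π-opp x = trans (sym (reverseᵛ-involutive (f x)))
    (cong reverseᵛ (fixing-units⇒identity (reverseᵛ ∘ f) rev-f-injective rev-f-∼ rev-f0 (rev-f-unit π-opp) x))

  rigidity : (∀ x → f x ≡ x) ⊎ (∀ x → f x ≡ reverseᵛ x)
  rigidity = Sum.map identity-case mirror-case (path-rigidity π ρ π-injective π∘ρ π-near π-near⁻)

unique⇒allPairs : {A : Set} {R : A → A → Set} {xs : List A} → Unique xs →
  (∀ {x y} → x ∈ xs → y ∈ xs → x ≢ y → R x y) → AllPairs R xs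
unique⇒allPairs []             _ = []
unique⇒allPairs (x∉ ∷ unique) R-distinct =
  All.tabulate (λ y∈ → R-distinct (here refl) (there y∈) (All.lookup x∉ y∈))
  ∷ unique⇒allPairs unique (λ x∈ y∈ → R-distinct (there x∈) (there y∈))

module InvolutionOrbits (G : Graph) (ρ : V G → V G) (ρ-involutive : ∀ x → ρ (ρ x) ≡ x)
  (orbit-refl : ∀ x → SameOrbit G x x) (orbit-ρ : ∀ x → SameOrbit G x (ρ x))
  (same-orbit⇒ : ∀ {x y} → SameOrbit G x y → y ≡ x ⊎ y ≡ ρ x) where

  Fixed : V G → Set
  Fixed x = ρ x ≡ x

  same-orbit⇐ : ∀ {x y} → y ≡ x ⊎ y ≡ ρ x → SameOrbit G x y
  same-orbit⇐ {x} (inj₁ refl) = orbit-refl x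
  same-orbit⇐ {x} (inj₂ refl) = orbit-ρ x

  orbit-of-fixed : ∀ {x y} → Fixed x → SameOrbit G x y → y ≡ x
  orbit-of-fixed fixed xy with same-orbit⇒ xy
  ... | inj₁ y≡x  = y≡x
  ... | inj₂ y≡ρx = trans y≡ρx fixed

  fixed⇒size1 : ∀ {x} → Fixed x → OrbitSize G x 1
  fixed⇒size1 {x} fixed = x ∷ [] , [] ∷ [] , refl , λ y → mk⇔ (λ xy → here (orbit-of-fixed fixed xy)) (from y)
    where
    from : ∀ y → y ∈ x ∷ [] → SameOrbit G x y
    from y (here y≡x) = same-orbit⇐ (inj₁ y≡x)

  moved⇒size2 : ∀ {x} → ¬ Fixed x → OrbitSize G x 2
  moved⇒size2 {x} moved = x ∷ ρ x ∷ [] , ((λ e → moved (sym e)) ∷ []) ∷ [] ∷ [] , refl , λ y → mk⇔ to (from y)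
    where
    to : ∀ {y} → SameOrbit G x y → y ∈ x ∷ ρ x ∷ []
    to xy with same-orbit⇒ xy
    ... | inj₁ y≡x  = here y≡x
    ... | inj₂ y≡ρx = there (here y≡ρx)
    from : ∀ y → y ∈ x ∷ ρ x ∷ [] → SameOrbit G x y
    from y (here y≡x)          = same-orbit⇐ (inj₁ y≡x)
    from y (there (here y≡ρx)) = same-orbit⇐ (inj₂ y≡ρx)

  size1⇒fixed : ∀ {x} → OrbitSize G x 1 → Fixed x
  size1⇒fixed {x} (a ∷ [] , _ , _ , orbit) with Equivalence.to (orbit x) (orbit-refl x) | Equivalence.to (orbit (ρ x)) (orbit-ρ x)
  ... | here x≡a | here ρx≡a = trans ρx≡a (sym x≡a)

  size2⇒moved : ∀ {x} → OrbitSize G x 2 → ¬ Fixed x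
  size2⇒moved {x} (a ∷ b ∷ [] , ((a≢b ∷ []) ∷ _) , _ , orbit) fixed =
    a≢b (trans (orbit-of-fixed fixed (Equivalence.from (orbit a) (here refl)))
               (sym (orbit-of-fixed fixed (Equivalence.from (orbit b) (there (here refl))))))

  record FixedPointList (fs : List (V G)) : Set where
    field
      unique   : Unique fs
      fixed    : All Fixed fs
      complete : ∀ x → Fixed x → x ∈ fs

  record PairRepresentatives (ms : List (V G)) : Set where
    field
      unique     : Unique ms
      no-partner : ∀ {x y} → x ∈ ms → y ∈ ms → y ≢ ρ x
      complete   : ∀ x → ¬ Fixed x → x ∈ ms ⊎ ρ x ∈ ms

    moved : ∀ {x} → x ∈ ms → ¬ Fixed x
    moved x∈ fixed = no-partner x∈ x∈ (sym fixed)

    separated : AllPairs (λ x y → ¬ SameOrbit G x y) ms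
    separated = unique⇒allPairs unique λ x∈ y∈ x≢y xy → [ (λ y≡x → x≢y (sym y≡x)) , no-partner x∈ y∈ ]′ (same-orbit⇒ xy)

    reaches : ∀ x → ¬ Fixed x → Any (λ r → SameOrbit G r x) ms
    reaches x moved with complete x moved
    ... | inj₁ x∈  = Any.map (λ { refl → orbit-refl x }) x∈
    ... | inj₂ ρx∈ = Any.map (λ { refl → subst (SameOrbit G (ρ x)) (ρ-involutive x) (orbit-ρ (ρ x)) }) ρx∈

  module _ {fs : List (V G)} (F : FixedPointList fs) where
    open FixedPointList F

    fixed-separated : AllPairs (λ x y → ¬ SameOrbit G x y) fs
    fixed-separated = unique⇒allPairs unique λ x∈ y∈ x≢y xy → x≢y (sym (orbit-of-fixed (All.lookup fixed x∈) xy))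

    fixed-reaches : ∀ x → Fixed x → Any (λ r → SameOrbit G r x) fs
    fixed-reaches x fx = Any.map (λ { refl → orbit-refl x }) (complete x fx)

    orbits-of-size-1 : NumOrbitsOfSize G 1 (length fs)
    orbits-of-size-1 = fs , refl , fixed-separated , All.map fixed⇒size1 fixed , λ x size → fixed-reaches x (size1⇒fixed size)

  orbits-of-size-2 : ∀ {ms} → PairRepresentatives ms → NumOrbitsOfSize G 2 (length ms)
  orbits-of-size-2 {ms} P = ms , refl , separated , All.tabulate (λ x∈ → moved⇒size2 (moved x∈)) ,
                            λ x size → reaches x (size2⇒moved size)
    where open PairRepresentatives P

  all-orbits : ∀ {fs ms} → (∀ x → Dec (Fixed x)) → FixedPointList fs → PairRepresentatives ms →
    NumOrbits G (length fs + length ms)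
  all-orbits {fs} {ms} fixed? F P =
    fs ++ ms , length-++ fs , AllPairs.++⁺ (fixed-separated F) separated (All.map apart (FixedPointList.fixed F)) , reach
    where
    open PairRepresentatives P
    apart : ∀ {a} → Fixed a → All (λ b → ¬ SameOrbit G a b) ms
    apart fa = All.tabulate λ b∈ ab → moved b∈ (subst Fixed (sym (orbit-of-fixed fa ab)) fa)
    reach : ∀ x → Any (λ r → SameOrbit G r x) (fs ++ ms)
    reach x with fixed? x
    ... | yes fx = AnyProperties.++⁺ˡ (fixed-reaches F x fx)
    ... | no  mx = AnyProperties.++⁺ʳ fs (reaches x mx)

bit-true : {b : Bool} → T b → bit b ≡ 1
bit-true {true} _ = refl

bit-false : {b : Bool} → ¬ T b → bit b ≡ 0
bit-false {true}  ¬t = ⊥-elim (¬t tt)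
bit-false {false} _  = refl

count : {A : Set} → (A → Bool) → List A → ℕ
count p []       = 0
count p (x ∷ xs) = bit (p x) + count p xs

module _ {A : Set} where

  count-++ : (p : A → Bool) (xs ys : List A) → count p (xs ++ ys) ≡ count p xs + count p ys
  count-++ p []       ys = refl
  count-++ p (x ∷ xs) ys = trans (cong (bit (p x) +_) (count-++ p xs ys)) (sym (+-assoc (bit (p x)) _ _))

  count-cong : {p q : A → Bool} → (∀ x → p x ≡ q x) → (xs : List A) → count p xs ≡ count q xs
  count-cong p≗q []       = refl
  count-cong p≗q (x ∷ xs) = cong₂ _+_ (cong bit (p≗q x)) (count-cong p≗q xs)

  count-false : {p : A → Bool} → (∀ x → p x ≡ false) → (xs : List A) → count p xs ≡ 0
  count-false p≗false []       = refl
  count-false p≗false (x ∷ xs) = cong₂ _+_ (cong bit (p≗false x)) (count-false p≗false xs)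

  count-map : {B : Set} (p : B → Bool) (f : A → B) (xs : List A) → count p (map f xs) ≡ count (p ∘ f) xs
  count-map p f []       = refl
  count-map p f (x ∷ xs) = cong (bit (p (f x)) +_) (count-map p f xs)

  count-split₃ : {p q r s : A → Bool} → (∀ x → bit (p x) ≡ bit (q x) + (bit (r x) + bit (s x))) →
    (xs : List A) → count p xs ≡ count q xs + (count r xs + count s xs)
  count-split₃ split []       = refl
  count-split₃ {p} {q} {r} {s} split (x ∷ xs) = begin
    bit (p x) + count p xs                                        ≡⟨ cong₂ _+_ (split x) (count-split₃ split xs) ⟩
    (bit (q x) + (bit (r x) + bit (s x))) + (count q xs + (count r xs + count s xs))
                                                                  ≡⟨ interchange (bit (q x)) (bit (r x)) (bit (s x)) _ _ _ ⟩
    (bit (q x) + count q xs) + ((bit (r x) + count r xs) + (bit (s x) + count s xs)) ∎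
    where
    open ≡-Reasoning
    interchange : ∀ a b c d e f → (a + (b + c)) + (d + (e + f)) ≡ (a + d) + ((b + e) + (c + f))
    interchange = solve-∀

words : (n : ℕ) → List (Vec Bool n)
words zero    = [] ∷ []
words (suc n) = map (false ∷_) (words n) ++ map (true ∷_) (words n)

words-complete : (v : Vec Bool n) → v ∈ words n
words-complete []          = here refl
words-complete (false ∷ v) = ∈-++⁺ˡ (∈-map⁺ (false ∷_) (words-complete v))
words-complete {suc n} (true ∷ v) = ∈-++⁺ʳ (map (false ∷_) (words n)) (∈-map⁺ (true ∷_) (words-complete v))

words-unique : (n : ℕ) → Unique (words n)
words-unique zero    = [] ∷ []
words-unique (suc n) = Unique.++⁺ (Unique.map⁺ ∷-injectiveʳ (words-unique n)) (Unique.map⁺ ∷-injectiveʳ (words-unique n)) heads-differ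
  where
  ∷-injectiveʳ : ∀ {a} {u v : Vec Bool n} → a ∷ u ≡ a ∷ v → u ≡ v
  ∷-injectiveʳ refl = refl
  heads-differ : ∀ {v} → v ∈ map (false ∷_) (words n) × v ∈ map (true ∷_) (words n) → ⊥
  heads-differ (v∈₀ , v∈₁) with ∈-map⁻ (false ∷_) v∈₀ | ∈-map⁻ (true ∷_) v∈₁
  ... | _ , _ , refl | _ , _ , ()

count-words-∷ : (n : ℕ) (p : Vec Bool (suc n) → Bool) →
  count p (words (suc n)) ≡ count (p ∘ (false ∷_)) (words n) + count (p ∘ (true ∷_)) (words n)
count-words-∷ n p = trans (count-++ p (map (false ∷_) (words n)) _)
                            (cong₂ _+_ (count-map p _ (words n)) (count-map p _ (words n)))

count-words-∷ʳ : (n : ℕ) (p : Vec Bool (suc n) → Bool) →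
  count p (words (suc n)) ≡ count (λ w → p (w ∷ʳ false)) (words n) + count (λ w → p (w ∷ʳ true)) (words n)
count-words-∷ʳ zero    p = cong₂ _+_ (sym (+-identityʳ (bit (p (false ∷ []))))) refl
count-words-∷ʳ (suc n) p = begin
  count p (words (suc (suc n)))
    ≡⟨ count-words-∷ (suc n) p ⟩
  count (p ∘ (false ∷_)) (words (suc n)) + count (p ∘ (true ∷_)) (words (suc n))
    ≡⟨ cong₂ _+_ (count-words-∷ʳ n (p ∘ (false ∷_))) (count-words-∷ʳ n (p ∘ (true ∷_))) ⟩
  (c false false + c false true) + (c true false + c true true)
    ≡⟨ interchange (c false false) (c false true) (c true false) (c true true) ⟩
  (c false false + c true false) + (c false true + c true true)
    ≡⟨ cong₂ _+_ (count-words-∷ n (λ w → p (w ∷ʳ false))) (count-words-∷ n (λ w → p (w ∷ʳ true))) ⟨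
  count (λ w → p (w ∷ʳ false)) (words (suc n)) + count (λ w → p (w ∷ʳ true)) (words (suc n)) ∎
  where
  open ≡-Reasoning
  c : Bool → Bool → ℕ
  c a b = count (λ w → p (a ∷ (w ∷ʳ b))) (words n)
  interchange : ∀ a b c d → (a + b) + (c + d) ≡ (a + c) + (b + d)
  interchange = solve-∀

count-words-reverse : (n : ℕ) (p : Vec Bool n → Bool) → count p (words n) ≡ count (p ∘ reverse) (words n)
count-words-reverse zero    p = refl
count-words-reverse (suc n) p = begin
  count p (words (suc n))
    ≡⟨ count-words-∷ʳ n p ⟩
  count (λ w → p (w ∷ʳ false)) (words n) + count (λ w → p (w ∷ʳ true)) (words n)
    ≡⟨ cong₂ _+_ (count-words-reverse n (λ w → p (w ∷ʳ false))) (count-words-reverse n (λ w → p (w ∷ʳ true))) ⟩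
  count (λ w → p (reverse w ∷ʳ false)) (words n) + count (λ w → p (reverse w ∷ʳ true)) (words n)
    ≡⟨ cong₂ _+_ (count-cong (λ w → cong p (reverse-∷ false w)) (words n)) (count-cong (λ w → cong p (reverse-∷ true w)) (words n)) ⟨
  count (p ∘ reverse ∘ (false ∷_)) (words n) + count (p ∘ reverse ∘ (true ∷_)) (words n)
    ≡⟨ count-words-∷ n (p ∘ reverse) ⟨
  count (p ∘ reverse) (words (suc n)) ∎
  where open ≡-Reasoning

count-words-wrap : (n : ℕ) (p : Vec Bool (suc (suc n)) → Bool) → count p (words (suc (suc n))) ≡
  (count (λ w → p (false ∷ (w ∷ʳ false))) (words n) + count (λ w → p (false ∷ (w ∷ʳ true))) (words n)) +
  (count (λ w → p (true ∷ (w ∷ʳ false))) (words n) + count (λ w → p (true ∷ (w ∷ʳ true))) (words n))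
count-words-wrap n p = trans (count-words-∷ (suc n) p) (cong₂ _+_ (count-words-∷ʳ n (p ∘ (false ∷_))) (count-words-∷ʳ n (p ∘ (true ∷_))))

noCons-false-∷ : (v : Vec Bool n) → noCons (false ∷ v) ≡ noCons v
noCons-false-∷ []      = refl
noCons-false-∷ (_ ∷ _) = refl

-- Γ_n has F_{n+2} vertices: a Fibonacci word starts with 0 or with 10.
count-fibonacci : (n : ℕ) → count noCons (words n) ≡ F (n + 2)
count-fibonacci zero          = refl
count-fibonacci (suc zero)    = refl
count-fibonacci (suc (suc n)) = begin
  count noCons (words (suc (suc n)))
    ≡⟨ count-words-∷ (suc n) noCons ⟩
  count (noCons ∘ (false ∷_)) (words (suc n)) + count (noCons ∘ (true ∷_)) (words (suc n))
    ≡⟨ cong (count (noCons ∘ (false ∷_)) (words (suc n)) +_) (count-words-∷ n (noCons ∘ (true ∷_))) ⟩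
  count (noCons ∘ (false ∷_)) (words (suc n)) +
    (count (λ w → noCons (false ∷ w)) (words n) + count (λ w → noCons (true ∷ true ∷ w)) (words n))
    ≡⟨ cong₂ _+_ (count-cong noCons-false-∷ (words (suc n)))
                 (cong₂ _+_ (count-cong noCons-false-∷ (words n)) (count-false (λ _ → refl) (words n))) ⟩
  count noCons (words (suc n)) + (count noCons (words n) + 0)
    ≡⟨ cong₂ _+_ (count-fibonacci (suc n)) (trans (+-identityʳ _) (count-fibonacci n)) ⟩
  F (suc (suc n) + 2) ∎
  where open ≡-Reasoning

_≐_ : Vec Bool n → Vec Bool n → Bool
[]      ≐ []      = true
(a ∷ u) ≐ (b ∷ v) = not (xor a b) ∧ (u ≐ v)

≐-refl : (u : Vec Bool n) → u ≐ u ≡ true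
≐-refl []          = refl
≐-refl (true ∷ u)  = ≐-refl u
≐-refl (false ∷ u) = ≐-refl u

≐⇒≡ : (u v : Vec Bool n) → u ≐ v ≡ true → u ≡ v
≐⇒≡ []          []          _ = refl
≐⇒≡ (true ∷ u)  (true ∷ v)  e = cong (true ∷_) (≐⇒≡ u v e)
≐⇒≡ (false ∷ u) (false ∷ v) e = cong (false ∷_) (≐⇒≡ u v e)

≐-∷ʳ : (u v : Vec Bool n) (a b : Bool) → (u ∷ʳ a) ≐ (v ∷ʳ b) ≡ (u ≐ v) ∧ not (xor a b)
≐-∷ʳ []      []      a b = ∧-identityʳ _
≐-∷ʳ (c ∷ u) (d ∷ v) a b = trans (cong (not (xor c d) ∧_) (≐-∷ʳ u v a b)) (sym (∧-assoc (not (xor c d)) _ _))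

palindrome : Vec Bool n → Bool
palindrome v = v ≐ reverse v

reverse-∷ʳ : (w : Vec Bool n) (b : Bool) → reverse (w ∷ʳ b) ≡ b ∷ reverse w
reverse-∷ʳ w b = begin
  reverse (w ∷ʳ b)                      ≡⟨ cong reverse (cong (_∷ʳ b) (reverse-involutive w)) ⟨
  reverse (reverse (reverse w) ∷ʳ b)    ≡⟨ cong reverse (reverse-∷ b (reverse w)) ⟨
  reverse (reverse (b ∷ reverse w))     ≡⟨ reverse-involutive (b ∷ reverse w) ⟩
  b ∷ reverse w                         ∎
  where open ≡-Reasoning

palindrome-wrap : (a : Bool) (w : Vec Bool n) (b : Bool) →
  palindrome (a ∷ (w ∷ʳ b)) ≡ not (xor a b) ∧ (palindrome w ∧ not (xor b a))
palindrome-wrap a w b = begin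
  (a ∷ (w ∷ʳ b)) ≐ reverse (a ∷ (w ∷ʳ b))      ≡⟨ cong ((a ∷ (w ∷ʳ b)) ≐_) (reverse-∷ a (w ∷ʳ b)) ⟩
  (a ∷ (w ∷ʳ b)) ≐ (reverse (w ∷ʳ b) ∷ʳ a)     ≡⟨ cong (λ v → (a ∷ (w ∷ʳ b)) ≐ (v ∷ʳ a)) (reverse-∷ʳ w b) ⟩
  not (xor a b) ∧ ((w ∷ʳ b) ≐ (reverse w ∷ʳ a)) ≡⟨ cong (not (xor a b) ∧_) (≐-∷ʳ w (reverse w) b a) ⟩
  not (xor a b) ∧ (palindrome w ∧ not (xor b a)) ∎
  where open ≡-Reasoning

fibPalindrome : Vec Bool n → Bool
fibPalindrome v = noCons v ∧ palindrome v

fibPalindrome-0w0 : (w : Vec Bool n) → fibPalindrome (false ∷ (w ∷ʳ false)) ≡ fibPalindrome w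
fibPalindrome-0w0 w = begin
  noCons (false ∷ (w ∷ʳ false)) ∧ palindrome (false ∷ (w ∷ʳ false))
    ≡⟨ cong₂ _∧_ (trans (noCons-false-∷ (w ∷ʳ false)) (noCons-∷ʳ w false)) (palindrome-wrap false w false) ⟩
  (noCons w ∧ not (lastᵇ w ∧ false)) ∧ (palindrome w ∧ true)
    ≡⟨ cong₂ (λ x y → (noCons w ∧ not x) ∧ y) (∧-zeroʳ (lastᵇ w)) (∧-identityʳ (palindrome w)) ⟩
  (noCons w ∧ true) ∧ palindrome w
    ≡⟨ cong (_∧ palindrome w) (∧-identityʳ (noCons w)) ⟩
  fibPalindrome w ∎
  where open ≡-Reasoning

fibPalindrome-0w1 : (w : Vec Bool n) → fibPalindrome (false ∷ (w ∷ʳ true)) ≡ false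
fibPalindrome-0w1 w = trans (cong (noCons (false ∷ (w ∷ʳ true)) ∧_) (palindrome-wrap false w true)) (∧-zeroʳ _)

fibPalindrome-1w0 : (w : Vec Bool n) → fibPalindrome (true ∷ (w ∷ʳ false)) ≡ false
fibPalindrome-1w0 w = trans (cong (noCons (true ∷ (w ∷ʳ false)) ∧_) (palindrome-wrap true w false)) (∧-zeroʳ _)

fibPalindrome-10u01 : (u : Vec Bool n) → fibPalindrome (true ∷ ((false ∷ (u ∷ʳ false)) ∷ʳ true)) ≡ fibPalindrome u
fibPalindrome-10u01 u = trans (cong₂ _∧_ noCons-10u01 palindrome-10u01) (fibPalindrome-0w0 u)
  where
  open ≡-Reasoning
  noCons-10u01 : noCons (true ∷ ((false ∷ (u ∷ʳ false)) ∷ʳ true)) ≡ noCons (false ∷ (u ∷ʳ false))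
  noCons-10u01 = begin
    noCons (false ∷ ((u ∷ʳ false) ∷ʳ true))                    ≡⟨ noCons-false-∷ ((u ∷ʳ false) ∷ʳ true) ⟩
    noCons ((u ∷ʳ false) ∷ʳ true)                             ≡⟨ noCons-∷ʳ (u ∷ʳ false) true ⟩
    noCons (u ∷ʳ false) ∧ not (lastᵇ (u ∷ʳ false) ∧ true)     ≡⟨ cong (λ b → noCons (u ∷ʳ false) ∧ not (b ∧ true)) (lastᵇ-∷ʳ u false) ⟩
    noCons (u ∷ʳ false) ∧ true                                ≡⟨ ∧-identityʳ _ ⟩
    noCons (u ∷ʳ false)                                       ≡⟨ noCons-false-∷ (u ∷ʳ false) ⟨
    noCons (false ∷ (u ∷ʳ false))                             ∎
  palindrome-10u01 : palindrome (true ∷ ((false ∷ (u ∷ʳ false)) ∷ʳ true)) ≡ palindrome (false ∷ (u ∷ʳ false))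
  palindrome-10u01 = trans (palindrome-wrap true (false ∷ (u ∷ʳ false)) true) (∧-identityʳ _)

fibPalindrome-10u11 : (u : Vec Bool n) → fibPalindrome (true ∷ ((false ∷ (u ∷ʳ true)) ∷ʳ true)) ≡ false
fibPalindrome-10u11 u = begin
  noCons w ∧ palindrome w                           ≡⟨ cong (noCons w ∧_) (palindrome-wrap true (false ∷ (u ∷ʳ true)) true) ⟩
  noCons w ∧ (palindrome (false ∷ (u ∷ʳ true)) ∧ true) ≡⟨ cong (λ b → noCons w ∧ (b ∧ true)) (palindrome-wrap false u true) ⟩
  noCons w ∧ false                                  ≡⟨ ∧-zeroʳ (noCons w) ⟩
  false                                             ∎
  where
  open ≡-Reasoning
  w = true ∷ ((false ∷ (u ∷ʳ true)) ∷ʳ true)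

fibPalindrome-11 : (w : Vec Bool n) → fibPalindrome (true ∷ true ∷ w) ≡ false
fibPalindrome-11 w = refl

count-fibPalindrome-step : (n : ℕ) →
  count fibPalindrome (words (suc (suc (suc (suc n))))) ≡ count fibPalindrome (words (suc (suc n))) + count fibPalindrome (words n)
count-fibPalindrome-step n = begin
  count fibPalindrome (words (4+n))
    ≡⟨ count-words-wrap (2+n) fibPalindrome ⟩
  (count (λ w → fibPalindrome (false ∷ (w ∷ʳ false))) (words (2+n)) + count (λ w → fibPalindrome (false ∷ (w ∷ʳ true))) (words (2+n))) +
  (count (λ w → fibPalindrome (true ∷ (w ∷ʳ false))) (words (2+n)) + count (λ w → fibPalindrome (true ∷ (w ∷ʳ true))) (words (2+n)))
    ≡⟨ cong₂ _+_ (cong₂ _+_ (count-cong fibPalindrome-0w0 (words (2+n))) (count-false fibPalindrome-0w1 (words (2+n))))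
                 (cong₂ _+_ (count-false fibPalindrome-1w0 (words (2+n))) (count-words-wrap n (λ w → fibPalindrome (true ∷ (w ∷ʳ true))))) ⟩
  (count fibPalindrome (words (2+n)) + 0) +
  (0 + ((count (λ u → fibPalindrome (true ∷ ((false ∷ (u ∷ʳ false)) ∷ʳ true))) (words n) +
         count (λ u → fibPalindrome (true ∷ ((false ∷ (u ∷ʳ true)) ∷ʳ true))) (words n)) +
        (count (λ u → fibPalindrome (true ∷ ((true ∷ (u ∷ʳ false)) ∷ʳ true))) (words n) +
         count (λ u → fibPalindrome (true ∷ ((true ∷ (u ∷ʳ true)) ∷ʳ true))) (words n))))
    ≡⟨ cong₂ (λ a b → a + (0 + b)) (+-identityʳ (count fibPalindrome (words 2+n)))
         (cong₂ _+_ (cong₂ _+_ (count-cong fibPalindrome-10u01 (words n)) (count-false fibPalindrome-10u11 (words n)))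
                    (cong₂ _+_ (count-false (λ u → fibPalindrome-11 ((u ∷ʳ false) ∷ʳ true)) (words n))
                               (count-false (λ u → fibPalindrome-11 ((u ∷ʳ true) ∷ʳ true)) (words n)))) ⟩
  count fibPalindrome (words (2+n)) + ((count fibPalindrome (words n) + 0) + 0)
    ≡⟨ cong (count fibPalindrome (words (2+n)) +_) (trans (+-identityʳ _) (+-identityʳ _)) ⟩
  count fibPalindrome (words (2+n)) + count fibPalindrome (words n) ∎
  where
  open ≡-Reasoning
  2+n = suc (suc n)
  4+n = suc (suc 2+n)

idx-step : (n : ℕ) → idx (suc (suc (suc n))) ≡ suc (idx (suc n))
idx-step n rewrite not-involutive (isEven (suc n)) with isEven (suc n)
... | true  = refl
... | false = refl

count-fibPalindrome : (n : ℕ) → count fibPalindrome (words n) ≡ F (idx n + 2)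
count-fibPalindrome 0 = refl
count-fibPalindrome 1 = refl
count-fibPalindrome 2 = refl
count-fibPalindrome 3 = refl
count-fibPalindrome 4 = refl
count-fibPalindrome (suc (suc (suc (suc (suc n))))) = begin
  count fibPalindrome (words (5 + n))                                 ≡⟨ count-fibPalindrome-step (suc n) ⟩
  count fibPalindrome (words (3 + n)) + count fibPalindrome (words (1 + n)) ≡⟨ cong₂ _+_ (count-fibPalindrome (suc (suc (suc n)))) (count-fibPalindrome (suc n)) ⟩
  F (idx (3 + n) + 2) + F (idx (1 + n) + 2)                           ≡⟨ cong (λ m → F (m + 2) + F (idx (1 + n) + 2)) (idx-step n) ⟩
  F (suc (idx (1 + n) + 2)) + F (idx (1 + n) + 2)                     ≡⟨ cong (λ m → F (m + 2)) (trans (idx-step (2 + n)) (cong suc (idx-step n))) ⟨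
  F (idx (5 + n) + 2)                                                 ∎
  where open ≡-Reasoning

lex< : Vec Bool n → Vec Bool n → Bool
lex< []      []      = false
lex< (a ∷ u) (b ∷ v) = if xor a b then b else lex< u v

lex<-asym : (u w : Vec Bool n) → lex< u w ≡ true → lex< w u ≡ true → ⊥
lex<-asym []          []          ()
lex<-asym (true ∷ u)  (true ∷ w)  = lex<-asym u w
lex<-asym (false ∷ u) (false ∷ w) = lex<-asym u w
lex<-asym (true ∷ u)  (false ∷ w) ()

lex<-total : (u w : Vec Bool n) → u ≢ w → lex< u w ≡ true ⊎ lex< w u ≡ true
lex<-total []          []          u≢w = ⊥-elim (u≢w refl)
lex<-total (true ∷ u)  (true ∷ w)  u≢w = lex<-total u w (λ e → u≢w (cong (true ∷_) e))
lex<-total (false ∷ u) (false ∷ w) u≢w = lex<-total u w (λ e → u≢w (cong (false ∷_) e))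
lex<-total (true ∷ u)  (false ∷ w) _   = inj₂ refl
lex<-total (false ∷ u) (true ∷ w)  _   = inj₁ refl

trichotomy : (u w : Vec Bool n) → bit (u ≐ w) + (bit (lex< u w) + bit (lex< w u)) ≡ 1
trichotomy []          []          = refl
trichotomy (true ∷ u)  (true ∷ w)  = trichotomy u w
trichotomy (false ∷ u) (false ∷ w) = trichotomy u w
trichotomy (true ∷ u)  (false ∷ w) = refl
trichotomy (false ∷ u) (true ∷ w)  = refl

fibSmaller fibGreater : Vec Bool n → Bool
fibSmaller v = noCons v ∧ lex< v (reverse v)
fibGreater v = noCons v ∧ lex< (reverse v) v

-- Reversal exchanges the two kinds, so they are equally many.
count-fibGreater : (n : ℕ) → count fibGreater (words n) ≡ count fibSmaller (words n)
count-fibGreater n = trans (count-words-reverse n fibGreater) (count-cong reversed (words n))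
  where
  reversed : ∀ v → fibGreater (reverse v) ≡ fibSmaller v
  reversed v = cong₂ (λ b w → b ∧ lex< w (reverse v)) (noCons-reverse v) (reverse-involutive v)

count-fibonacci-split : (n : ℕ) →
  F (n + 2) ≡ count fibPalindrome (words n) + (count fibSmaller (words n) + count fibSmaller (words n))
count-fibonacci-split n = begin
  F (n + 2)                      ≡⟨ count-fibonacci n ⟨
  count noCons (words n)         ≡⟨ count-split₃ compare (words n) ⟩
  count fibPalindrome (words n) + (count fibSmaller (words n) + count fibGreater (words n))
                                 ≡⟨ cong (λ m → count fibPalindrome (words n) + (count fibSmaller (words n) + m)) (count-fibGreater n) ⟩
  count fibPalindrome (words n) + (count fibSmaller (words n) + count fibSmaller (words n)) ∎
  where
  open ≡-Reasoning
  compare : ∀ v → bit (noCons v) ≡ bit (fibPalindrome v) + (bit (fibSmaller v) + bit (fibGreater v))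
  compare v with noCons v
  ... | true  = sym (trichotomy v (reverse v))
  ... | false = refl

select : (Vec Bool n → Bool) → List (Vec Bool n) → List (Vertex n)
select p []       = []
select p (v ∷ vs) with T? (noCons v ∧ p v)
... | yes passes = (v , proj₁ (Equivalence.to T-∧ passes)) ∷ select p vs
... | no  _      = select p vs

length-select : (p : Vec Bool n → Bool) (vs : List (Vec Bool n)) → length (select p vs) ≡ count (λ v → noCons v ∧ p v) vs
length-select p []       = refl
length-select p (v ∷ vs) with T? (noCons v ∧ p v)
... | yes passes = cong₂ _+_ (sym (bit-true passes)) (length-select p vs)
... | no  fails  = cong₂ _+_ (sym (bit-false fails)) (length-select p vs)

∈-select⁻ : (p : Vec Bool n → Bool) (vs : List (Vec Bool n)) {x : Vertex n} → x ∈ select p vs → proj₁ x ∈ vs × T (p (proj₁ x))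
∈-select⁻ p (v ∷ vs) x∈ with T? (noCons v ∧ p v)
∈-select⁻ p (v ∷ vs) (here refl) | yes passes = here refl , proj₂ (Equivalence.to T-∧ passes)
∈-select⁻ p (v ∷ vs) (there x∈)  | yes _      = Product.map₁ there (∈-select⁻ p vs x∈)
∈-select⁻ p (v ∷ vs) x∈          | no  _      = Product.map₁ there (∈-select⁻ p vs x∈)

∈-select⁺ : (p : Vec Bool n → Bool) (vs : List (Vec Bool n)) (x : Vertex n) → proj₁ x ∈ vs → T (p (proj₁ x)) → x ∈ select p vs
∈-select⁺ p (v ∷ vs) x v∈ px with T? (noCons v ∧ p v)
∈-select⁺ p (v ∷ vs) (v , h) (here refl) px | yes _ = here (vertex-≡ refl)
∈-select⁺ p (v ∷ vs) (v , h) (here refl) px | no ¬passes = ⊥-elim (¬passes (Equivalence.from T-∧ (h , px)))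
∈-select⁺ p (v ∷ vs) x       (there v∈)  px | yes _ = there (∈-select⁺ p vs x v∈ px)
∈-select⁺ p (v ∷ vs) x       (there v∈)  px | no  _ = ∈-select⁺ p vs x v∈ px

select-unique : (p : Vec Bool n → Bool) {vs : List (Vec Bool n)} → Unique vs → Unique (select p vs)
select-unique p []                    = []
select-unique p {v ∷ vs} (v∉ ∷ unique) with T? (noCons v ∧ p v)
... | yes _ = All.tabulate (λ y∈ e → All.lookup v∉ (proj₁ (∈-select⁻ p vs y∈)) (cong proj₁ e)) ∷ select-unique p unique
... | no  _ = select-unique p unique

identityAut : Aut (Γ n)
identityAut = record { perm = mk↔ₛ′ id id (λ _ → refl) (λ _ → refl) ; preserve = λ _ _ → mk⇔ id id }

reverseAut : Aut (Γ n)
reverseAut = record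
  { perm     = mk↔ₛ′ reverseᵛ reverseᵛ reverseᵛ-involutive reverseᵛ-involutive
  ; preserve = λ x y → mk⇔ (subst id (reverseᵛ-∼ x y)) (subst id (sym (reverseᵛ-∼ x y))) }

same-orbit⇒ : {k : ℕ} {x y : Vertex (suc (suc k))} → SameOrbit (Γ (suc (suc k))) x y → y ≡ x ⊎ y ≡ reverseᵛ x
same-orbit⇒ {x = x} (σ , σx≡y) =
  Sum.map (λ σ-id → trans (sym σx≡y) (σ-id x)) (λ σ-rev → trans (sym σx≡y) (σ-rev x)) (Rigidity.rigidity σ)

palindrome⇒fixed : (x : Vertex n) → palindrome (proj₁ x) ≡ true → reverseᵛ x ≡ x
palindrome⇒fixed (v , _) pal = vertex-≡ (sym (≐⇒≡ v (reverse v) pal))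

fixed⇒palindrome : (x : Vertex n) → reverseᵛ x ≡ x → palindrome (proj₁ x) ≡ true
fixed⇒palindrome (v , _) fixed = subst (λ w → v ≐ w ≡ true) (sym (cong proj₁ fixed)) (≐-refl v)

-- Halving the counts: with F = P + 2S, ⌊(F - P)/2⌋ = S and ⌊(F + P)/2⌋ = P + S.
half-difference : (p s : ℕ) → ⌊ p + (s + s) ∸ p /2⌋ ≡ s
half-difference p s = trans (cong ⌊_/2⌋ (m+n∸m≡n p (s + s))) (sym (n≡⌊n+n/2⌋ s))

half-sum : (p s : ℕ) → ⌊ p + (s + s) + p /2⌋ ≡ p + s
half-sum p s = trans (cong ⌊_/2⌋ (regroup p s)) (sym (n≡⌊n+n/2⌋ (p + s)))
  where
  regroup : ∀ p s → p + (s + s) + p ≡ (p + s) + (p + s)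
  regroup = solve-∀

module FibonacciCubeOrbits (k : ℕ) where

  private
    N : ℕ
    N = suc (suc k)

  open InvolutionOrbits (Γ N) reverseᵛ reverseᵛ-involutive (λ x → identityAut , refl) (λ x → reverseAut , refl) same-orbit⇒ public

  smallerThanReverse : Vec Bool N → Bool
  smallerThanReverse v = lex< v (reverse v)

  palindromes smaller : List (Vertex N)
  palindromes = select palindrome (words N)
  smaller     = select smallerThanReverse (words N)

  palindromes-fixed : FixedPointList palindromes
  palindromes-fixed = record
    { unique   = select-unique palindrome (words-unique N)
    ; fixed    = All.tabulate λ {x} x∈ → palindrome⇒fixed x (Equivalence.to T-≡ (proj₂ (∈-select⁻ palindrome (words N) x∈)))
    ; complete = λ x fx → ∈-select⁺ palindrome (words N) x (words-complete (proj₁ x)) (Equivalence.from T-≡ (fixed⇒palindrome x fx))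
    }

  smaller-representatives : PairRepresentatives smaller
  smaller-representatives = record
    { unique     = select-unique smallerThanReverse (words-unique N)
    ; no-partner = no-partner
    ; complete   = complete
    }
    where
    smaller⇒ : ∀ {x} → x ∈ smaller → lex< (proj₁ x) (reverse (proj₁ x)) ≡ true
    smaller⇒ x∈ = Equivalence.to T-≡ (proj₂ (∈-select⁻ smallerThanReverse (words N) x∈))
    no-partner : ∀ {x y} → x ∈ smaller → y ∈ smaller → y ≢ reverseᵛ x
    no-partner {x} x∈ y∈ refl = lex<-asym (proj₁ x) (reverse (proj₁ x)) (smaller⇒ x∈)
      (trans (cong (lex< (reverse (proj₁ x))) (sym (reverse-involutive (proj₁ x)))) (smaller⇒ y∈))
    complete : ∀ x → reverseᵛ x ≢ x → x ∈ smaller ⊎ reverseᵛ x ∈ smaller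
    complete x@(v , _) moved with lex<-total v (reverse v) (λ v≡ → moved (vertex-≡ (sym v≡)))
    ... | inj₁ v<rv = inj₁ (∈-select⁺ smallerThanReverse (words N) x (words-complete v) (Equivalence.from T-≡ v<rv))
    ... | inj₂ rv<v = inj₂ (∈-select⁺ smallerThanReverse (words N) (reverseᵛ x) (words-complete (reverse v))
                             (Equivalence.from T-≡ (trans (cong (lex< (reverse v)) (reverse-involutive v)) rv<v)))

  fixed? : (x : Vertex N) → Dec (reverseᵛ x ≡ x)
  fixed? x with palindrome (proj₁ x) in pal
  ... | true  = yes (palindrome⇒fixed x pal)
  ... | false = no λ fx → true≢false (trans (sym (fixed⇒palindrome x fx)) pal)

  #palindromes : length palindromes ≡ F (idx N + 2)
  #palindromes = trans (length-select palindrome (words N)) (count-fibPalindrome N)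

  #smaller : length smaller ≡ ⌊ F (N + 2) ∸ F (idx N + 2) /2⌋
  #smaller = begin
    length smaller                                                        ≡⟨ length-select smallerThanReverse (words N) ⟩
    S                                                                     ≡⟨ half-difference P S ⟨
    ⌊ P + (S + S) ∸ P /2⌋                                                 ≡⟨ cong₂ (λ a b → ⌊ a ∸ b /2⌋) (count-fibonacci-split N) (sym (count-fibPalindrome N)) ⟨
    ⌊ F (N + 2) ∸ F (idx N + 2) /2⌋                                       ∎
    where
    open ≡-Reasoning
    P = count fibPalindrome (words N)
    S = count fibSmaller (words N)

  #orbits : length palindromes + length smaller ≡ ⌊ F (N + 2) + F (idx N + 2) /2⌋
  #orbits = begin
    length palindromes + length smaller  ≡⟨ cong₂ _+_ (length-select palindrome (words N)) (length-select smallerThanReverse (words N)) ⟩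
    P + S                                ≡⟨ half-sum P S ⟨
    ⌊ P + (S + S) + P /2⌋                ≡⟨ cong₂ (λ a b → ⌊ a + b /2⌋) (count-fibonacci-split N) (sym (count-fibPalindrome N)) ⟨
    ⌊ F (N + 2) + F (idx N + 2) /2⌋      ∎
    where
    open ≡-Reasoning
    P = count fibPalindrome (words N)
    S = count fibSmaller (words N)

theorem4p2 : (n : ℕ) → 2 ≤ n →
    NumOrbitsOfSize (Γ n) 1 (F (idx n + 2)) ×
    NumOrbitsOfSize (Γ n) 2 ⌊ F (n + 2) ∸ F (idx n + 2) /2⌋ ×
    NumOrbits (Γ n) ⌊ F (n + 2) + F (idx n + 2) /2⌋
theorem4p2 (suc zero) (s≤s ())
theorem4p2 (suc (suc k)) _ =
  subst (NumOrbitsOfSize (Γ (suc (suc k))) 1) #palindromes (orbits-of-size-1 palindromes-fixed) ,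
  subst (NumOrbitsOfSize (Γ (suc (suc k))) 2) #smaller (orbits-of-size-2 smaller-representatives) ,
  subst (NumOrbits (Γ (suc (suc k)))) #orbits (all-orbits fixed? palindromes-fixed smaller-representatives)
  where open FibonacciCubeOrbits k
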